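{- Let $T$ be a string of length $n$. For every non-empty substring $S$ of $T$ that is not a minimal substring of $T$, there exists a minimal substring $S_{\mathsf{min}}$ of $T$ which is a substring of $S$ and satisfies $\mathit{cover}(S_{\mathsf{min}}) \subseteq \mathit{cover}(S)$.
   Context: For a string $T = T[1]\cdots T[n]$ and $1\le i\le j\le n$, $T[i..j]=T[i]\cdots T[j]$. For a non-empty string $P$, $\mathit{occ}(P) = \{ i \mid 1 \le i \le n-|P|+1,\ T[i..i+|P|-1] = P\}$ is the set of starting positions of occurrences of $P$ in $T$, and $\mathit{cover}(P) = \{ i+k-1 \mid i \in \mathit{occ}(P),\ 1 \le k \le |P|\}$ is the set of text positions covered by occurrences of $P$. A substring $S$ of $T$ is a minimal substring of $T$ if every proper (non-empty) substring $S[i..j]$ of $S$ (i.e. $S[i..j]\neq S$) satisfies $|\mathit{occ}(S[i..j])| > |\mathit{occ}(S)|$. -}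

module Defs where

open import Data.Nat using (ℕ; _+_; _≤_; _<_)
open import Data.List using (List; []; length; take; drop; filter; upTo)
open import Data.List.Properties using (≡-dec)
open import Data.Product using (Σ; ∃; _×_)
open import Relation.Nullary using (¬_; Dec)
open import Relation.Binary.PropositionalEquality using (_≡_; _≢_)
open import Relation.Binary.Definitions using (DecidableEquality)

-- Positions are 0-based: i ∈ occ T P  iff  T[i .. i+|P|-1] = P,
-- i.e. the length-|P| window of T starting at i is exactly P
-- (taking a window that runs off the end of T yields a shorter list, so it cannot equal P).
OccAt : {A : Set} → List A → List A → ℕ → Set
OccAt T P i = take (length P) (drop i T) ≡ P

occAt? : {A : Set} → DecidableEquality A → (T P : List A) → (i : ℕ) → Dec (OccAt T P i)
occAt? _≟_ T P i = ≡-dec _≟_ (take (length P) (drop i T)) P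

-- |occ(P)| : number of starting positions i ∈ {0, …, n-1} of occurrences of P in T
-- (for non-empty P every occurrence starts below n = |T|).
occCount : {A : Set} → DecidableEquality A → List A → List A → ℕ
occCount _≟_ T P = length (filter (occAt? _≟_ T P) (upTo (length T)))

IsSubstring : {A : Set} → List A → List A → Set
IsSubstring T P = ∃ λ i → OccAt T P i

Covered : {A : Set} → List A → List A → ℕ → Set
Covered T P p = ∃ λ i → OccAt T P i × (i ≤ p) × (p < i + length P)

CoverSubset : {A : Set} → List A → List A → List A → Set
CoverSubset T P Q = ∀ p → Covered T P p → Covered T Q p

IsMinimal : {A : Set} → DecidableEquality A → List A → List A → Set
IsMinimal _≟_ T S =
  S ≢ [] × IsSubstring T S ×
  (∀ P → P ≢ [] → IsSubstring S P → P ≢ S → occCount _≟_ T S < occCount _≟_ T P)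

{-# OPTIONS --safe #-}
-- Every occurrence i of S yields the occurrence i + k of a factor P = S[k ..] of S, and distinct
-- occurrences of S yield distinct ones of P, so |occ(P)| ≥ |occ(S)|. If S is not minimal, some
-- proper factor P has |occ(P)| ≤ |occ(S)|; then equality holds, so every occurrence of P is of
-- this form, i.e. lies inside an occurrence of S, and cover(P) ⊆ cover(S). Recursing on the
-- shorter P eventually reaches a minimal substring.
module Submission where

open import Defs
open import Data.Empty using (⊥-elim)
open import Data.List using (List; []; _∷_; length; take; drop; filter; applyUpTo)
open import Data.List.Properties using (≡-dec; length-take; take-take; take-drop; drop-drop; take-[]; take-all)
open import Data.Nat using (ℕ; zero; suc; _+_; _∸_; _⊓_; _≤_; _<_; z≤n; s≤s; _≤?_; _<?_)
open import Data.Nat.Induction using (<-wellFounded)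
open import Data.Nat.Properties
open import Data.Product using (∃; ∃₂; _×_; _,_)
open import Data.Sum using (_⊎_; inj₁; inj₂)
open import Function using (_∘_)
open import Induction.WellFounded using (Acc; acc)
open import Relation.Binary.Definitions using (DecidableEquality)
open import Relation.Binary.PropositionalEquality using (_≡_; _≢_; refl; sym; trans; cong; subst; module ≡-Reasoning)
open import Relation.Nullary using (¬_; Dec; yes; no; ¬?; _×-dec_)
open import Relation.Unary using (Decidable)

countUpTo : {R : ℕ → Set} → Decidable R → (ℕ → ℕ) → ℕ → ℕ
countUpTo R? f m = length (filter R? (applyUpTo f m))

module _ {R R′ : ℕ → Set} (R? : Decidable R) (R′? : Decidable R′) where

  countUpTo-mono : ∀ f g m → (∀ {i} → i < m → R (f i) → R′ (g i)) →
                   countUpTo R? f m ≤ countUpTo R′? g m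
  countUpTo-mono f g zero    h = z≤n
  countUpTo-mono f g (suc m) h with R? (f 0) | R′? (g 0)
  ... | yes _  | yes _  = s≤s (countUpTo-mono (f ∘ suc) (g ∘ suc) m (h ∘ s≤s))
  ... | yes r  | no ¬r′ = ⊥-elim (¬r′ (h (s≤s z≤n) r))
  ... | no _   | yes _  = m≤n⇒m≤1+n (countUpTo-mono (f ∘ suc) (g ∘ suc) m (h ∘ s≤s))
  ... | no _   | no _   = countUpTo-mono (f ∘ suc) (g ∘ suc) m (h ∘ s≤s)

  countUpTo-mono-< : ∀ f g m → (∀ {i} → i < m → R (f i) → R′ (g i)) →
                     ∀ {j} → j < m → R′ (g j) → ¬ R (f j) →
                     countUpTo R? f m < countUpTo R′? g m
  countUpTo-mono-< f g (suc m) h {j} j<m r′ ¬r with R? (f 0) | R′? (g 0) | j | j<m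
  ... | yes r  | _      | zero  | _         = ⊥-elim (¬r r)
  ... | no _   | no ¬r′ | zero  | _         = ⊥-elim (¬r′ r′)
  ... | no _   | yes _  | zero  | _         = s≤s (countUpTo-mono (f ∘ suc) (g ∘ suc) m (h ∘ s≤s))
  ... | yes r  | no ¬r′ | suc _ | _         = ⊥-elim (¬r′ (h (s≤s z≤n) r))
  ... | yes _  | yes _  | suc _ | s≤s j<m′ = s≤s (countUpTo-mono-< (f ∘ suc) (g ∘ suc) m (h ∘ s≤s) j<m′ r′ ¬r)
  ... | no _   | yes _  | suc _ | s≤s j<m′ = m≤n⇒m≤1+n (countUpTo-mono-< (f ∘ suc) (g ∘ suc) m (h ∘ s≤s) j<m′ r′ ¬r)
  ... | no _   | no _   | suc _ | s≤s j<m′ = countUpTo-mono-< (f ∘ suc) (g ∘ suc) m (h ∘ s≤s) j<m′ r′ ¬r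

module _ {R : ℕ → Set} (R? : Decidable R) where

  countUpTo-pos : ∀ f m {j} → j < m → R (f j) → 0 < countUpTo R? f m
  countUpTo-pos f (suc m) {j} j<m r with R? (f 0) | j | j<m
  ... | yes _ | _     | _        = s≤s z≤n
  ... | no ¬r | zero  | _        = ⊥-elim (¬r r)
  ... | no _  | suc _ | s≤s j<m′ = countUpTo-pos (f ∘ suc) m j<m′ r

  countUpTo-zero : ∀ f m → (∀ {i} → i < m → ¬ R (f i)) → countUpTo R? f m ≡ 0
  countUpTo-zero f zero    h = refl
  countUpTo-zero f (suc m) h with R? (f 0)
  ... | yes r = ⊥-elim (h (s≤s z≤n) r)
  ... | no _  = countUpTo-zero (f ∘ suc) m (h ∘ s≤s)

  countUpTo-+ : ∀ f a b → countUpTo R? f (a + b) ≡ countUpTo R? f a + countUpTo R? (f ∘ (a +_)) b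
  countUpTo-+ f zero    b = refl
  countUpTo-+ f (suc a) b with R? (f 0)
  ... | yes _ = cong suc (countUpTo-+ (f ∘ suc) a b)
  ... | no _  = countUpTo-+ (f ∘ suc) a b

module _ {A : Set} where

  length-pos : {P : List A} → P ≢ [] → 0 < length P
  length-pos {[]}    P≢[] = ⊥-elim (P≢[] refl)
  length-pos {_ ∷ _} _    = s≤s z≤n

  take-length-take : ∀ m (xs : List A) → take (length (take m xs)) xs ≡ take m xs
  take-length-take zero    xs       = refl
  take-length-take (suc m) []       = refl
  take-length-take (suc m) (x ∷ xs) = cong (x ∷_) (take-length-take m xs)

  take-drop-take : ∀ m k l (xs : List A) → k + m ≤ l → take m (drop k (take l xs)) ≡ take m (drop k xs)
  take-drop-take m k l xs k+m≤l = begin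
    take m (drop k (take l xs))         ≡⟨ take-drop m k (take l xs) ⟩
    drop k (take (k + m) (take l xs))   ≡⟨ cong (drop k) (take-take (k + m) l xs) ⟩
    drop k (take ((k + m) ⊓ l) xs)      ≡⟨ cong (λ n → drop k (take n xs)) (m≤n⇒m⊓n≡m k+m≤l) ⟩
    drop k (take (k + m) xs)            ≡⟨ take-drop m k xs ⟨
    take m (drop k xs)                  ∎
    where open ≡-Reasoning

  occAt-bound : ∀ {T P : List A} i → OccAt T P i → P ≢ [] → i + length P ≤ length T
  occAt-bound {T}     {P} zero    o _    =
    subst (_≤ length T) (cong length o) (≤-trans (≤-reflexive (length-take (length P) T)) (m⊓n≤n _ _))
  occAt-bound {[]}    {P} (suc i) o P≢[] = ⊥-elim (P≢[] (trans (sym o) (take-[] (length P))))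
  occAt-bound {_ ∷ T}     (suc i) o P≢[] = s≤s (occAt-bound i o P≢[])

  occAt-start< : ∀ {T P : List A} {i} → OccAt T P i → P ≢ [] → i < length T
  occAt-start< {i = i} o P≢[] = <-≤-trans (m<m+n i (length-pos P≢[])) (occAt-bound i o P≢[])

  occAt-trans : ∀ {T S P : List A} {i k} → OccAt T S i → OccAt S P k → OccAt T P (i + k)
  occAt-trans {P = []}        _  _  = refl
  occAt-trans {T} {S} {P@(_ ∷ _)} {i} {k} oS oP = begin
    take (length P) (drop (i + k) T)                      ≡⟨ cong (take (length P)) (drop-drop i k T) ⟨
    take (length P) (drop k (drop i T))                   ≡⟨ take-drop-take (length P) k (length S) (drop i T) (occAt-bound k oP λ ()) ⟨
    take (length P) (drop k (take (length S) (drop i T))) ≡⟨ cong (take (length P) ∘ drop k) oS ⟩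
    take (length P) (drop k S)                            ≡⟨ oP ⟩
    P                                                     ∎
    where open ≡-Reasoning

  isSubstring-refl : (S : List A) → IsSubstring S S
  isSubstring-refl S = 0 , take-all (length S) S ≤-refl

  isSubstring-trans : ∀ {T S P : List A} → IsSubstring T S → IsSubstring S P → IsSubstring T P
  isSubstring-trans {T} {S} {P} (i , oS) (k , oP) = i + k , occAt-trans {T = T} {i = i} {k} oS oP

  occAt-same-length : ∀ {S P : List A} k → OccAt S P k → P ≢ [] → length P ≡ length S → P ≡ S
  occAt-same-length {S} zero o _ |P|≡|S| =
    trans (sym o) (trans (cong (λ m → take m S) |P|≡|S|) (take-all (length S) S ≤-refl))
  occAt-same-length {S} {P} (suc k) o P≢[] |P|≡|S| =
    ⊥-elim (<⇒≱ (m<n+m (length P) (s≤s z≤n)) (subst (suc k + length P ≤_) (sym |P|≡|S|) (occAt-bound {T = S} (suc k) o P≢[])))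

  occAt-proper-shorter : ∀ {S P : List A} {k} → OccAt S P k → P ≢ [] → P ≢ S → length P < length S
  occAt-proper-shorter {P = P} {k} o P≢[] P≢S =
    ≤∧≢⇒< (≤-trans (m≤n+m (length P) k) (occAt-bound k o P≢[])) (P≢S ∘ occAt-same-length k o P≢[])

module _ {A : Set} (_≟_ : DecidableEquality A) (T : List A) where

  private
    n : ℕ
    n = length T

    occ : List A → ℕ
    occ = occCount _≟_ T

    occ? : (P : List A) → Decidable (OccAt T P)
    occ? = occAt? _≟_ T

  occCount-split : ∀ {P} → P ≢ [] → ∀ k → occ P ≡ countUpTo (occ? P) (λ i → i) k + countUpTo (occ? P) (k +_) n
  occCount-split {P} P≢[] k = begin
    occ P                        ≡⟨ +-identityʳ (occ P) ⟨
    occ P + 0                    ≡⟨ cong (occ P +_) (countUpTo-zero (occ? P) (n +_) k beyond-end) ⟨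
    occ P + #from n k            ≡⟨ countUpTo-+ (occ? P) (λ i → i) n k ⟨
    #from 0 (n + k)              ≡⟨ cong (#from 0) (+-comm n k) ⟩
    #from 0 (k + n)              ≡⟨ countUpTo-+ (occ? P) (λ i → i) k n ⟩
    #from 0 k + #from k n        ∎
    where
    open ≡-Reasoning
    #from : ℕ → ℕ → ℕ
    #from a = countUpTo (occ? P) (a +_)
    beyond-end : ∀ {i} → i < k → ¬ OccAt T P (n + i)
    beyond-end {i} _ o = <⇒≱ (occAt-start< o P≢[]) (m≤m+n n i)

  shifted-occurrence : ∀ {S P k} → OccAt S P k → ∀ {i} → i < n → OccAt T S i → OccAt T P (k + i)
  shifted-occurrence {P = P} {k} oP {i} _ oS = subst (OccAt T P) (+-comm i k) (occAt-trans {T = T} {i = i} {k} oS oP)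

  occurrence-inside : ∀ {S P k} → OccAt S P k → P ≢ [] → occ P ≤ occ S →
                      ∀ {j} → OccAt T P j → ∃ λ i → OccAt T S i × j ≡ k + i
  occurrence-inside {S} {P} {k} oP P≢[] occP≤occS {j} oj with k ≤? j
  ... | no k≰j = ⊥-elim (<⇒≱ occS<occP occP≤occS)
    where
    occS<occP : occ S < occ P
    occS<occP = subst (occ S <_) (sym (occCount-split P≢[] k))
      (+-mono-≤ (countUpTo-pos (occ? P) (λ i → i) k (≰⇒> k≰j) oj)
                (countUpTo-mono (occ? S) (occ? P) (λ i → i) (k +_) n (shifted-occurrence {k = k} oP)))
  ... | yes k≤j with occ? S (j ∸ k)
  ...   | yes oS = j ∸ k , oS , sym (m+[n∸m]≡n k≤j)
  ...   | no ¬oS = ⊥-elim (<⇒≱ occS<occP occP≤occS)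
    where
    occS<occP : occ S < occ P
    occS<occP = subst (occ S <_) (sym (occCount-split P≢[] k))
      (≤-trans (countUpTo-mono-< (occ? S) (occ? P) (λ i → i) (k +_) n (shifted-occurrence {k = k} oP)
                  (≤-<-trans (m∸n≤m j k) (occAt-start< oj P≢[]))
                  (subst (OccAt T P) (sym (m+[n∸m]≡n k≤j)) oj) ¬oS)
               (m≤n+m _ _))

  cover-inside : ∀ {S P k} → OccAt S P k → P ≢ [] → occ P ≤ occ S → CoverSubset T P S
  cover-inside {S} {P} {k} oP P≢[] occP≤occS p (j , oj , j≤p , p<j+|P|)
    with occurrence-inside {k = k} oP P≢[] occP≤occS {j} oj
  ... | i , oS , refl = i , oS , ≤-trans (m≤n+m i k) j≤p , <-≤-trans p<j+|P| end-inside
    where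
    end-inside : k + i + length P ≤ i + length S
    end-inside = begin
      k + i + length P    ≡⟨ cong (_+ length P) (+-comm k i) ⟩
      i + k + length P    ≡⟨ +-assoc i k (length P) ⟩
      i + (k + length P)  ≤⟨ +-monoʳ-≤ i (occAt-bound k oP P≢[]) ⟩
      i + length S        ∎
      where open ≤-Reasoning

  NonMinimalityWitness : List A → List A → Set
  NonMinimalityWitness S P = P ≢ [] × P ≢ S × occ P ≤ occ S

  nonMinimalityWitness? : ∀ S P → Dec (NonMinimalityWitness S P)
  nonMinimalityWitness? S P = ¬? (≡-dec _≟_ P []) ×-dec ¬? (≡-dec _≟_ P S) ×-dec (occ P ≤? occ S)

  minimal-or-witness : ∀ {S} → S ≢ [] → IsSubstring T S →
                       IsMinimal _≟_ T S ⊎ ∃₂ λ P k → OccAt S P k × NonMinimalityWitness S P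
  minimal-or-witness {S} S≢[] sub with anyUpTo? (λ k → anyUpTo? (witnessAt k) (suc (length S))) (length S)
    where
    witnessAt : ∀ k m → Dec (NonMinimalityWitness S (take m (drop k S)))
    witnessAt k m = nonMinimalityWitness? S (take m (drop k S))
  ... | yes (k , _ , m , _ , w) = inj₂ (_ , k , take-length-take m (drop k S) , w)
  ... | no noWitness            = inj₁ (S≢[] , sub , minimal)
    where
    minimal : ∀ P → P ≢ [] → IsSubstring S P → P ≢ S → occ S < occ P
    minimal P P≢[] (k , o) P≢S with occ S <? occ P
    ... | yes occS<occP = occS<occP
    ... | no occS≮occP  = ⊥-elim (noWitness (k , occAt-start< o P≢[] , length P ,
          s≤s (≤-trans (m≤n+m (length P) k) (occAt-bound k o P≢[])) ,
          subst (NonMinimalityWitness S) (sym o) (P≢[] , P≢S , ≮⇒≥ occS≮occP)))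

  minimal-substring-inside : ∀ S → Acc _<_ (length S) → S ≢ [] → IsSubstring T S →
                             ∃ λ Smin → IsMinimal _≟_ T Smin × IsSubstring S Smin × CoverSubset T Smin S
  minimal-substring-inside S (acc rec) S≢[] sub with minimal-or-witness S≢[] sub
  ... | inj₁ minimal = S , minimal , isSubstring-refl S , λ _ c → c
  ... | inj₂ (P , k , oP , P≢[] , P≢S , occP≤occS)
    with minimal-substring-inside P (rec (occAt-proper-shorter {k = k} oP P≢[] P≢S))
                                  P≢[] (isSubstring-trans {S = S} sub (k , oP))
  ...   | Smin , minimal , inP , coverP =
    Smin , minimal , isSubstring-trans {S = P} (k , oP) inP ,
    λ p → cover-inside {k = k} oP P≢[] occP≤occS p ∘ coverP p

lemma1 : {A : Set} (_≟_ : DecidableEquality A) (T S : List A) →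
         S ≢ [] → IsSubstring T S → ¬ IsMinimal _≟_ T S →
         ∃ λ Smin → IsMinimal _≟_ T Smin × IsSubstring S Smin × CoverSubset T Smin S
lemma1 _≟_ T S S≢[] sub _ = minimal-substring-inside _≟_ T S (<-wellFounded (length S)) S≢[] sub
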